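{- Let $m$ be the run-length encoding size of $T$. Then \[\mathcal{X}=\sum_{w\in B_2\cup B_3}\left(|K(w)|+\sum_{i=1}^{\lfloor m/2\rfloor-1}\ \sum_{z\in K^{(i)}_{+}(w)}|K(z)|\right).\]
   Context: $\Sigma$ is an ordered alphabet, $\$\notin\Sigma$, and $T$ is a string of length $n\ge3$ with $T[1]=T[n]=\$$ and $T[2..n-1]\in\Sigma^*$; $m$ is the number of maximal runs of equal characters in $T[2..n-1]$. For a string $w$, $R(w)$ is the number of maximal runs of equal characters in $w$. A string $w\in(\Sigma\cup\{\$\})^*$ with $|w|\ge2$ is a bridge if $w[1]\neq w[2]$ and $w[|w|-1]\neq w[|w|]$; $\mathcal{B}$ is the set of bridges that are substrings of $T$, and $B_\ell=\{w\in\mathcal{B}\mid R(w)=\ell\}$. For a string $w$ with $R(w)\ge3$, $w^{(1)}$ is obtained from $w$ by deleting its first and last runs and then shortening the new first and last runs to length 1; $w^{(1)}=\varepsilon$ if $R(w)\le2$; $w^{(t)}=(w^{(t-1)})^{(1)}$ for $t\ge2$. For $t\ge1$, $K^{(t)}(w)=\{w'\in\mathcal{B}\mid w'^{(t)}=w\}$, $K(w)=K^{(1)}(w)$, and $K^{(t)}_+(w)=\{w'\in K^{(t)}(w)\mid |K(w')|\ge2\}$. $\mathcal{W}$ is the set of bridges $w$ with $|K(w)|\ge2$ or $w\in B_2\cup B_3$, and $\mathcal{X}=\sum_{w\in\mathcal{W}}|K(w)|$. -}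

module Defs where

open import Data.Bool using (Bool; true; false; not; _∧_; _∨_; if_then_else_)
open import Data.Nat using (ℕ; zero; suc; _∸_; _+_; _≤ᵇ_; _≡ᵇ_; ⌊_/2⌋)
open import Data.List using (List; []; _∷_; _++_; [_]; map; length; reverse;
  concatMap; inits; tails; upTo; derun; dropWhile; filterᵇ; deduplicate)
open import Data.Nat.ListAction using (sum)
open import Data.List.Properties using (≡-dec)
open import Data.Maybe using (Maybe; just; nothing)
import Data.Maybe.Properties as MaybeP
open import Relation.Nullary using (does)
open import Relation.Binary.Definitions using (DecidableEquality)
open import Relation.Binary.PropositionalEquality using (_≡_)

-- Characters of Σ ∪ {$}: `just a` for a ∈ Σ, `nothing` for the sentinel $.
Char : Set → Set
Char Σ = Maybe Σ

module _ {Σ : Set} (_≟Σ_ : DecidableEquality Σ) where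

  _≟c_ : DecidableEquality (Char Σ)
  _≟c_ = MaybeP.≡-dec _≟Σ_

  _≟w_ : DecidableEquality (List (Char Σ))
  _≟w_ = ≡-dec _≟c_

  _==_ : Char Σ → Char Σ → Bool
  a == b = does (a ≟c b)

  text : List Σ → List (Char Σ)
  text s = nothing ∷ map just s ++ [ nothing ]

  R : List (Char Σ) → ℕ
  R w = length (derun _≟c_ w)

  firstTwoDiffer : List (Char Σ) → Bool
  firstTwoDiffer (x ∷ y ∷ _) = not (x == y)
  firstTwoDiffer _ = false

  isBridge : List (Char Σ) → Bool
  isBridge w = firstTwoDiffer w ∧ firstTwoDiffer (reverse w)

  substrings : List (Char Σ) → List (List (Char Σ))
  substrings t = concatMap inits (tails t)

  𝓑 : List Σ → List (List (Char Σ))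
  𝓑 s = deduplicate _≟w_ (filterᵇ isBridge (substrings (text s)))

  dropFirstRun : List (Char Σ) → List (Char Σ)
  dropFirstRun [] = []
  dropFirstRun (x ∷ xs) = dropWhile (x ≟c_) xs

  shortenFirstRun : List (Char Σ) → List (Char Σ)
  shortenFirstRun [] = []
  shortenFirstRun (x ∷ xs) = x ∷ dropWhile (x ≟c_) xs

  step : List (Char Σ) → List (Char Σ)
  step w = if R w ≤ᵇ 2 then []
           else reverse (shortenFirstRun (reverse (shortenFirstRun
                  (reverse (dropFirstRun (reverse (dropFirstRun w)))))))

  iter : ℕ → List (Char Σ) → List (Char Σ)
  iter zero w = w
  iter (suc t) w = step (iter t w)

  Kt : List Σ → ℕ → List (Char Σ) → List (List (Char Σ))
  Kt s t w = filterᵇ (λ w' → does (iter t w' ≟w w)) (𝓑 s)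

  K : List Σ → List (Char Σ) → List (List (Char Σ))
  K s = Kt s 1

  Kt₊ : List Σ → ℕ → List (Char Σ) → List (List (Char Σ))
  Kt₊ s t w = filterᵇ (λ w' → 2 ≤ᵇ length (K s w')) (Kt s t w)

  B₂₃ : List Σ → List (List (Char Σ))
  B₂₃ s = filterᵇ (λ w → (R w ≡ᵇ 2) ∨ (R w ≡ᵇ 3)) (𝓑 s)

  -- 𝒲 (restricted to 𝓑; bridges outside 𝓑 have K(w) = ∅ and contribute 0)
  𝒲 : List Σ → List (List (Char Σ))
  𝒲 s = filterᵇ (λ w → (2 ≤ᵇ length (K s w)) ∨ ((R w ≡ᵇ 2) ∨ (R w ≡ᵇ 3))) (𝓑 s)

  𝒳 : List Σ → ℕ
  𝒳 s = sum (map (λ w → length (K s w)) (𝒲 s))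

  -- m = number of runs of T[2..n-1]
  rleSize : List Σ → ℕ
  rleSize s = R (map just s)

  rhs : List Σ → ℕ
  rhs s = sum (map (λ w → length (K s w)
            + sum (map (λ i → sum (map (λ z → length (K s z)) (Kt₊ s i w)))
                       (map suc (upTo (⌊ rleSize s /2⌋ ∸ 1)))))
          (B₂₃ s))

-- Each reduction step removes exactly two runs and keeps an infix, and the reduct of a bridge
-- with at least four runs is again a bridge; so for a bridge z of T with R(z) ≥ 4 there is exactly
-- one i ≥ 1 with z⁽ⁱ⁾ ∈ B₂ ∪ B₃, namely i = ⌊(R(z) − 2)/2⌋, while no reduct of a bridge in
-- B₂ ∪ B₃ lies in B₂ ∪ B₃.  If K(z) ≠ ∅ then R(z) ≤ m, which puts this i in 1 … ⌊m/2⌋ − 1.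
-- Exchanging the order of summation, the double sum therefore counts |K(z)| exactly once for every
-- z ∈ 𝒲 outside B₂ ∪ B₃ (these are the z with |K(z)| ≥ 2), and the first summand accounts for
-- B₂ ∪ B₃.

module Submission where

open import Algebra.Properties.CommutativeSemigroup using (interchange)
open import Data.Bool using (Bool; true; false; T; not; _∧_; _∨_; if_then_else_)
open import Data.Bool.Properties using (T-≡)
open import Data.Empty using (⊥-elim)
open import Data.List
  using (List; []; _∷_; _++_; map; length; reverse; concatMap; inits; tails;
         upTo; derun; dropWhile; takeWhile; filterᵇ; _∷ʳ_)
open import Data.List.Properties
  using (map-∘; map-cong-local; map-applyUpTo; ++-assoc; ++-identityʳ; reverse-++;
         reverse-involutive; unfold-reverse; length-reverse; length-derun;
         derun-accept; takeWhile++dropWhile)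
open import Data.List.Membership.Propositional using (_∈_; _∉_)
open import Data.List.Membership.Propositional.Properties
  using (∈-filter⁻; ∈-filter⁺; ∈-deduplicate⁻; ∈-deduplicate⁺; ∈-concatMap⁻;
         ∈-concatMap⁺; ∈-map⁻; ∈-map⁺)
open import Data.List.Relation.Unary.All using (tabulate; lookup)
open import Data.List.Relation.Unary.AllPairs using ([]; _∷_)
open import Data.List.Relation.Unary.Any using (Any; here; there)
open import Data.List.Relation.Unary.Unique.Propositional using (Unique)
open import Data.List.Relation.Unary.Unique.DecPropositional.Properties using (deduplicate-!)
open import Data.Nat using (ℕ; zero; suc; _+_; _*_; _∸_; _≤_; z≤n; s≤s; _≤ᵇ_; _≡ᵇ_; ⌊_/2⌋)
open import Data.Nat.ListAction using (sum)
open import Data.Nat.Properties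
open import Data.Maybe using (just; nothing)
open import Data.Product using (∃; ∃₂; _×_; _,_; proj₁; proj₂)
open import Data.Unit using (tt)
open import Function using (_∘_; Equivalence)
open import Relation.Binary.Definitions using (DecidableEquality)
open import Relation.Binary.PropositionalEquality
open import Relation.Nullary using (¬_; yes; no; does)
open import Relation.Nullary.Decidable using (Dec; dec-false; T?)
open import Relation.Nullary.Reflects using (ofʸ; ofⁿ)
open import Defs

open ≡-Reasoning

-- Sums over lists

when : Bool → ℕ → ℕ
when b n = if b then n else 0

∑ : {A : Set} → List A → (A → ℕ) → ℕ
∑ xs g = sum (map g xs)

syntax ∑ xs (λ x → e) = ∑[ x ∈ xs ] e

when-false : ∀ {b} n → ¬ T b → when b n ≡ 0
when-false {false} n _ = refl
when-false {true} n ¬b = ⊥-elim (¬b tt)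

when-zero : ∀ b → when b 0 ≡ 0
when-zero true = refl
when-zero false = refl

when-+ : ∀ b m n → when b (m + n) ≡ when b m + when b n
when-+ true m n = refl
when-+ false m n = refl

when-comm : ∀ a b n → when a (when b n) ≡ when b (when a n)
when-comm true b n = refl
when-comm false true n = refl
when-comm false false n = refl

module _ {A : Set} where

  ∑-filterᵇ : ∀ (p : A → Bool) (g : A → ℕ) xs →
              ∑[ x ∈ filterᵇ p xs ] g x ≡ ∑[ x ∈ xs ] when (p x) (g x)
  ∑-filterᵇ p g [] = refl
  ∑-filterᵇ p g (x ∷ xs) with p x
  ... | true = cong (g x +_) (∑-filterᵇ p g xs)
  ... | false = ∑-filterᵇ p g xs

  ∑-cong : ∀ {g h : A → ℕ} xs → (∀ {x} → x ∈ xs → g x ≡ h x) → ∑ xs g ≡ ∑ xs h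
  ∑-cong xs g≡h = cong sum (map-cong-local (tabulate g≡h))

  ∑-zero : ∀ {g : A → ℕ} xs → (∀ {x} → x ∈ xs → g x ≡ 0) → ∑ xs g ≡ 0
  ∑-zero [] _ = refl
  ∑-zero (x ∷ xs) g≡0 = cong₂ _+_ (g≡0 (here refl)) (∑-zero xs (g≡0 ∘ there))

  ∑-+ : ∀ (g h : A → ℕ) xs → ∑[ x ∈ xs ] (g x + h x) ≡ ∑ xs g + ∑ xs h
  ∑-+ g h [] = refl
  ∑-+ g h (x ∷ xs) = trans (cong (g x + h x +_) (∑-+ g h xs))
                           (interchange +-commutativeSemigroup (g x) (h x) (∑ xs g) (∑ xs h))

  when-∑ : ∀ b (g : A → ℕ) xs → when b (∑ xs g) ≡ ∑[ x ∈ xs ] when b (g x)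
  when-∑ true g xs = refl
  when-∑ false g xs = sym (∑-zero xs (λ _ → refl))

∑-swap : ∀ {A B : Set} (g : A → B → ℕ) xs ys →
         ∑[ x ∈ xs ] ∑[ y ∈ ys ] g x y ≡ ∑[ y ∈ ys ] ∑[ x ∈ xs ] g x y
∑-swap g [] ys = sym (∑-zero ys (λ _ → refl))
∑-swap g (x ∷ xs) ys = trans (cong (∑ ys (g x) +_) (∑-swap g xs ys)) (sym (∑-+ (g x) _ ys))

∑-swap₃ : ∀ {A B C : Set} (h : A → B → C → ℕ) xs ys zs →
          ∑[ x ∈ xs ] ∑[ y ∈ ys ] ∑[ z ∈ zs ] h x y z ≡ ∑[ z ∈ zs ] ∑[ y ∈ ys ] ∑[ x ∈ xs ] h x y z
∑-swap₃ h xs ys zs = begin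
  ∑[ x ∈ xs ] ∑[ y ∈ ys ] ∑[ z ∈ zs ] h x y z  ≡⟨ ∑-cong xs (λ {x} _ → ∑-swap (h x) ys zs) ⟩
  ∑[ x ∈ xs ] ∑[ z ∈ zs ] ∑[ y ∈ ys ] h x y z  ≡⟨ ∑-swap (λ x z → ∑[ y ∈ ys ] h x y z) xs zs ⟩
  ∑[ z ∈ zs ] ∑[ x ∈ xs ] ∑[ y ∈ ys ] h x y z  ≡⟨ ∑-cong zs (λ {z} _ → ∑-swap (λ x y → h x y z) xs ys) ⟩
  ∑[ z ∈ zs ] ∑[ y ∈ ys ] ∑[ x ∈ xs ] h x y z  ∎

∑-map-suc : ∀ (g : ℕ → ℕ) ns → ∑[ i ∈ map suc ns ] g i ≡ ∑[ j ∈ ns ] g (suc j)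
∑-map-suc g ns = cong sum (sym (map-∘ ns))

∑-upTo-suc : ∀ (g : ℕ → ℕ) N → ∑[ i ∈ upTo (suc N) ] g i ≡ g 0 + ∑[ i ∈ map suc (upTo N) ] g i
∑-upTo-suc g N = cong (λ gs → g 0 + sum gs)
  (trans (map-applyUpTo suc g N) (trans (sym (map-applyUpTo (λ i → i) (g ∘ suc) N)) (map-∘ (upTo N))))

module _ {A : Set} (_≟_ : DecidableEquality A) where

  ∑-select : ∀ {g : A → ℕ} {v} xs → Unique xs → (v ∉ xs → g v ≡ 0) →
             ∑[ x ∈ xs ] when (does (v ≟ x)) (g x) ≡ g v
  ∑-select [] [] g≡0 = sym (g≡0 λ ())
  ∑-select {g} {v} (x ∷ xs) (x∉xs ∷ xs!) g≡0 with v ≟ x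
  ... | yes refl = trans (cong (g v +_) (∑-zero xs λ x′∈xs →
                     cong (λ b → when b _) (dec-false (v ≟ _) (lookup x∉xs x′∈xs))))
                   (+-identityʳ (g v))
  ... | no v≢x = ∑-select xs xs! λ v∉xs → g≡0 λ { (here v≡x) → v≢x v≡x ; (there v∈xs) → v∉xs v∈xs }

-- Which reduction of a bridge lands in B₂ ∪ B₃

isShort : ℕ → Bool
isShort n = (n ≡ᵇ 2) ∨ (n ≡ᵇ 3)

isShort⇒2≤ : ∀ {n} → T (isShort n) → 2 ≤ n
isShort⇒2≤ {suc (suc n)} _ = s≤s (s≤s z≤n)

isShort-≤1 : ∀ {n} → n ≤ 1 → isShort n ≡ false
isShort-≤1 z≤n = refl
isShort-≤1 (s≤s z≤n) = refl

isShort-4≤ : ∀ {n} → 4 ≤ n → isShort n ≡ false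
isShort-4≤ (s≤s (s≤s (s≤s (s≤s _)))) = refl

2+n∸2*suc : ∀ n j → (2 + n) ∸ 2 * suc j ≡ n ∸ 2 * j
2+n∸2*suc n j = cong ((2 + n) ∸_) (*-suc 2 j)

∑-isShort-∸-tail : ∀ k N c → k ≤ 1 →
  ∑[ i ∈ map suc (upTo N) ] when (isShort ((2 + k) ∸ 2 * i)) c ≡ 0
∑-isShort-∸-tail k N c k≤1 =
  trans (∑-map-suc (λ i → when (isShort ((2 + k) ∸ 2 * i)) c) (upTo N))
        (∑-zero (upTo N) λ {j} _ → cong (λ b → when b c)
          (trans (cong isShort (2+n∸2*suc k j)) (isShort-≤1 (≤-trans (m∸n≤m k (2 * j)) k≤1))))

∑-isShort-∸ : ∀ {n} N c → 2 ≤ n → n ≤ 3 + 2 * N →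
  when (isShort n) c + ∑[ i ∈ map suc (upTo N) ] when (isShort (n ∸ 2 * i)) c ≡ c
∑-isShort-∸ {0} N c () _
∑-isShort-∸ {1} N c (s≤s ()) _
∑-isShort-∸ {2} N c _ _ = trans (cong (c +_) (∑-isShort-∸-tail 0 N c z≤n)) (+-identityʳ c)
∑-isShort-∸ {3} N c _ _ = trans (cong (c +_) (∑-isShort-∸-tail 1 N c ≤-refl)) (+-identityʳ c)
∑-isShort-∸ {suc (suc (suc (suc _)))} zero c _ (s≤s (s≤s (s≤s ())))
∑-isShort-∸ {suc (suc n@(suc (suc _)))} (suc N) c _ (s≤s (s≤s n≤1+2*sucN)) = begin
  when (isShort (2 + n)) c + ∑[ i ∈ map suc (upTo (suc N)) ] when (isShort ((2 + n) ∸ 2 * i)) c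
    ≡⟨ cong₂ _+_ (cong (λ b → when b c) (isShort-4≤ {2 + n} (s≤s (s≤s (s≤s (s≤s z≤n))))))
                 (∑-map-suc (λ i → when (isShort ((2 + n) ∸ 2 * i)) c) (upTo (suc N))) ⟩
  ∑[ j ∈ upTo (suc N) ] when (isShort ((2 + n) ∸ 2 * suc j)) c
    ≡⟨ ∑-cong (upTo (suc N)) (λ {j} _ → cong (λ k → when (isShort k) c) (2+n∸2*suc n j)) ⟩
  ∑[ j ∈ upTo (suc N) ] when (isShort (n ∸ 2 * j)) c
    ≡⟨ ∑-upTo-suc _ N ⟩
  when (isShort n) c + ∑[ i ∈ map suc (upTo N) ] when (isShort (n ∸ 2 * i)) c
    ≡⟨ ∑-isShort-∸ N c (s≤s (s≤s z≤n)) (subst (n ≤_) (cong suc (*-suc 2 N)) n≤1+2*sucN) ⟩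
  c ∎

m≤3+2*[⌊m/2⌋∸1] : ∀ m → m ≤ 3 + 2 * (⌊ m /2⌋ ∸ 1)
m≤3+2*[⌊m/2⌋∸1] 0 = z≤n
m≤3+2*[⌊m/2⌋∸1] 1 = s≤s z≤n
m≤3+2*[⌊m/2⌋∸1] 2 = s≤s (s≤s z≤n)
m≤3+2*[⌊m/2⌋∸1] 3 = ≤-refl
m≤3+2*[⌊m/2⌋∸1] (suc (suc m@(suc (suc k)))) =
  subst (2 + m ≤_) (cong (3 +_) (sym (*-suc 2 ⌊ k /2⌋))) (s≤s (s≤s (m≤3+2*[⌊m/2⌋∸1] m)))

-- Infixes and runs

module _ {A : Set} where

  Infix : List A → List A → Set
  Infix v t = ∃₂ λ a b → t ≡ a ++ v ++ b

  infix-refl : ∀ t → Infix t t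
  infix-refl t = [] , [] , sym (++-identityʳ t)

  suffix⇒infix : ∀ {v t} q → t ≡ q ++ v → Infix v t
  suffix⇒infix {v} q t≡q++v = q , [] , trans t≡q++v (cong (q ++_) (sym (++-identityʳ v)))

  infix-trans : ∀ {u v t} → Infix u v → Infix v t → Infix u t
  infix-trans {u} {v} {t} (c , d , v≡cud) (a , b , t≡avb) = a ++ c , d ++ b , (begin
    t                        ≡⟨ t≡avb ⟩
    a ++ v ++ b              ≡⟨ cong (λ v → a ++ v ++ b) v≡cud ⟩
    a ++ (c ++ u ++ d) ++ b  ≡⟨ cong (a ++_) (++-assoc c (u ++ d) b) ⟩
    a ++ c ++ (u ++ d) ++ b  ≡⟨ cong (λ w → a ++ c ++ w) (++-assoc u d b) ⟩
    a ++ c ++ u ++ d ++ b    ≡⟨ ++-assoc a c (u ++ d ++ b) ⟨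
    (a ++ c) ++ u ++ d ++ b  ∎)

  infix-reverse : ∀ {v t} → Infix v t → Infix (reverse v) (reverse t)
  infix-reverse {v} {t} (a , b , t≡avb) = reverse b , reverse a , (begin
    reverse t                                  ≡⟨ cong reverse t≡avb ⟩
    reverse (a ++ v ++ b)                      ≡⟨ reverse-++ a (v ++ b) ⟩
    reverse (v ++ b) ++ reverse a              ≡⟨ cong (_++ reverse a) (reverse-++ v b) ⟩
    (reverse b ++ reverse v) ++ reverse a      ≡⟨ ++-assoc (reverse b) (reverse v) (reverse a) ⟩
    reverse b ++ reverse v ++ reverse a        ∎)

  infix-reverse-conj : (f : List A → List A) → (∀ u → Infix (f u) u) →
                       ∀ u → Infix (reverse (f (reverse u))) u
  infix-reverse-conj f f-infix u =
    subst (Infix _) (reverse-involutive u) (infix-reverse (f-infix (reverse u)))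

  ∈-inits⁻ : ∀ {v : List A} u → v ∈ inits u → ∃ λ b → u ≡ v ++ b
  ∈-inits⁻ u (here refl) = u , refl
  ∈-inits⁻ (x ∷ u) (there v∈) with ∈-map⁻ (x ∷_) v∈
  ... | v′ , v′∈ , refl = let b , u≡v′b = ∈-inits⁻ u v′∈ in b , cong (x ∷_) u≡v′b

  ∈-inits⁺ : ∀ (v b : List A) → v ∈ inits (v ++ b)
  ∈-inits⁺ [] b = here refl
  ∈-inits⁺ (x ∷ v) b = there (∈-map⁺ (x ∷_) (∈-inits⁺ v b))

  ∈-substrings⁻ : ∀ {v : List A} t → v ∈ concatMap inits (tails t) → Infix v t
  ∈-substrings⁻ t v∈ = go t (∈-concatMap⁻ inits {xs = tails t} v∈)
    where
      go : ∀ {v : List A} t → Any (λ u → v ∈ inits u) (tails t) → Infix v t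
      go t (here v∈) = let b , t≡vb = ∈-inits⁻ t v∈ in [] , b , t≡vb
      go (x ∷ t) (there v∈) = let a , b , t≡avb = go t v∈ in x ∷ a , b , cong (x ∷_) t≡avb

  ∈-substrings⁺ : ∀ {v t : List A} → Infix v t → v ∈ concatMap inits (tails t)
  ∈-substrings⁺ {v} (a , b , refl) = ∈-concatMap⁺ inits (go a)
    where
      go : ∀ (a : List A) → Any (λ u → v ∈ inits u) (tails (a ++ v ++ b))
      go [] = here (∈-inits⁺ v b)
      go (x ∷ a) = there (go a)

module Runs {A : Set} (_≟_ : DecidableEquality A) where

  runs : List A → ℕ
  runs xs = length (derun _≟_ xs)

  runs-∷-≢ : ∀ {x y} ys → x ≢ y → runs (x ∷ y ∷ ys) ≡ suc (runs (y ∷ ys))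
  runs-∷-≢ ys x≢y = cong length (derun-accept _≟_ ys x≢y)

  runs-∷-≤ : ∀ x ys → runs (x ∷ ys) ≤ suc (runs ys)
  runs-∷-≤ x [] = s≤s z≤n
  runs-∷-≤ x (y ∷ ys) with x ≟ y
  ... | yes _ = n≤1+n _
  ... | no _ = ≤-refl

  runs-++-≤ : ∀ xs ys → runs (xs ++ ys) ≤ runs xs + runs ys
  runs-++-≤ [] ys = ≤-refl
  runs-++-≤ (x ∷ []) ys = runs-∷-≤ x ys
  runs-++-≤ (x ∷ xs@(x′ ∷ _)) ys with runs-++-≤ xs ys | x ≟ x′
  ... | ih | yes _ = ih
  ... | ih | no _ = s≤s ih

  runs-≤-∷ : ∀ x ys → runs ys ≤ runs (x ∷ ys)
  runs-≤-∷ x [] = z≤n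
  runs-≤-∷ x (y ∷ ys) with x ≟ y
  ... | yes _ = ≤-refl
  ... | no _ = n≤1+n _

  runs-suffix-≤ : ∀ xs ys → runs ys ≤ runs (xs ++ ys)
  runs-suffix-≤ [] ys = ≤-refl
  runs-suffix-≤ (x ∷ xs) ys = ≤-trans (runs-suffix-≤ xs ys) (runs-≤-∷ x (xs ++ ys))

  runs-++-∷ : ∀ xs y ys → runs (xs ++ y ∷ ys) + 1 ≡ runs (xs ∷ʳ y) + runs (y ∷ ys)
  runs-++-∷ [] y ys = +-comm _ 1
  runs-++-∷ (x ∷ []) y ys with x ≟ y
  ... | yes _ = +-comm _ 1
  ... | no _ = cong suc (+-comm _ 1)
  runs-++-∷ (x ∷ xs@(x′ ∷ _)) y ys with runs-++-∷ xs y ys | x ≟ x′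
  ... | ih | yes _ = ih
  ... | ih | no _ = cong suc ih

  runs-pair-comm : ∀ x y → runs (x ∷ y ∷ []) ≡ runs (y ∷ x ∷ [])
  runs-pair-comm x y with x ≟ y | y ≟ x
  ... | yes _ | yes _ = refl
  ... | no _ | no _ = refl
  ... | yes x≡y | no y≢x = ⊥-elim (y≢x (sym x≡y))
  ... | no x≢y | yes y≡x = ⊥-elim (x≢y (sym y≡x))

  runs-reverse : ∀ xs → runs (reverse xs) ≡ runs xs
  runs-reverse [] = refl
  runs-reverse (x ∷ []) = refl
  runs-reverse (x ∷ y ∷ xs) = +-cancelʳ-≡ 1 _ _ (begin
    runs (reverse (x ∷ y ∷ xs)) + 1
      ≡⟨ cong (λ zs → runs zs + 1) (reverse-++ (x ∷ y ∷ []) xs) ⟩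
    runs (reverse xs ++ y ∷ x ∷ []) + 1
      ≡⟨ runs-++-∷ (reverse xs) y (x ∷ []) ⟩
    runs (reverse xs ∷ʳ y) + runs (y ∷ x ∷ [])
      ≡⟨ cong₂ _+_ (trans (cong runs (sym (unfold-reverse y xs))) (runs-reverse (y ∷ xs)))
                   (runs-pair-comm y x) ⟩
    runs (y ∷ xs) + runs (x ∷ y ∷ [])
      ≡⟨ +-comm (runs (y ∷ xs)) _ ⟩
    runs (x ∷ y ∷ []) + runs (y ∷ xs)
      ≡⟨ runs-++-∷ (x ∷ []) y xs ⟨
    runs (x ∷ y ∷ xs) + 1 ∎)

  runs-prefix-≤ : ∀ xs ys → runs xs ≤ runs (xs ++ ys)
  runs-prefix-≤ xs ys =
    subst₂ _≤_ (runs-reverse xs) (trans (cong runs (sym (reverse-++ xs ys))) (runs-reverse (xs ++ ys)))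
      (runs-suffix-≤ (reverse ys) (reverse xs))

  runs-infix-≤ : ∀ {v t} → Infix v t → runs v ≤ runs t
  runs-infix-≤ {v} (a , b , refl) = ≤-trans (runs-prefix-≤ v b) (runs-suffix-≤ a (v ++ b))

  runs-∷≡suc-dropWhile : ∀ x xs → runs (x ∷ xs) ≡ suc (runs (dropWhile (x ≟_) xs))
  runs-∷≡suc-dropWhile x [] = refl
  runs-∷≡suc-dropWhile x (y ∷ ys) with x ≟ y
  ... | yes refl = runs-∷≡suc-dropWhile x ys
  ... | no _ = refl

  runs-∷-dropWhile : ∀ x xs → runs (x ∷ dropWhile (x ≟_) xs) ≡ runs (x ∷ xs)
  runs-∷-dropWhile x [] = refl
  runs-∷-dropWhile x (y ∷ ys) with x ≟ y
  ... | yes refl = runs-∷-dropWhile x ys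
  ... | no x≢y = runs-∷-≢ ys x≢y

-- The reduction w ↦ w⁽¹⁾

module Steps {Σ : Set} (_≟_ : DecidableEquality Σ) where

  open Runs (_≟c_ _≟_)

  private
    _≟ᶜ_ : DecidableEquality (Char Σ)
    _≟ᶜ_ = _≟c_ _≟_

  dropFirstRun-infix : ∀ w → Infix (dropFirstRun _≟_ w) w
  dropFirstRun-infix [] = infix-refl []
  dropFirstRun-infix (x ∷ xs) =
    suffix⇒infix (x ∷ takeWhile (x ≟ᶜ_) xs) (cong (x ∷_) (sym (takeWhile++dropWhile (x ≟ᶜ_) xs)))

  runs-dropFirstRun : ∀ w → runs (dropFirstRun _≟_ w) ≡ runs w ∸ 1
  runs-dropFirstRun [] = refl
  runs-dropFirstRun (x ∷ xs) = cong (_∸ 1) (sym (runs-∷≡suc-dropWhile x xs))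

  shortenFirstRun-suffix : ∀ w → ∃ λ q → w ≡ q ++ shortenFirstRun _≟_ w
  shortenFirstRun-suffix [] = [] , refl
  shortenFirstRun-suffix (x ∷ []) = [] , refl
  shortenFirstRun-suffix (x ∷ y ∷ ys) with shortenFirstRun-suffix (x ∷ ys) | x ≟ᶜ y
  ... | q , x∷ys≡q++ | yes refl = x ∷ q , cong (x ∷_) x∷ys≡q++
  ... | _ | no _ = [] , refl

  shortenFirstRun-infix : ∀ w → Infix (shortenFirstRun _≟_ w) w
  shortenFirstRun-infix w = let q , w≡q++ = shortenFirstRun-suffix w in suffix⇒infix q w≡q++

  runs-shortenFirstRun : ∀ w → runs (shortenFirstRun _≟_ w) ≡ runs w
  runs-shortenFirstRun [] = refl
  runs-shortenFirstRun (x ∷ xs) = runs-∷-dropWhile x xs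

  firstTwoDiffer-shortenFirstRun : ∀ w → 2 ≤ runs w → firstTwoDiffer _≟_ (shortenFirstRun _≟_ w) ≡ true
  firstTwoDiffer-shortenFirstRun (x ∷ xs) = go xs
    where
      go : ∀ xs → 2 ≤ runs (x ∷ xs) → firstTwoDiffer _≟_ (x ∷ dropWhile (x ≟ᶜ_) xs) ≡ true
      go [] (s≤s ())
      go (y ∷ ys) 2≤runs with x ≟ᶜ y
      ... | yes refl = go ys 2≤runs
      ... | no x≢y = cong not (dec-false (x ≟ᶜ y) x≢y)

  firstTwoDiffer-++ : ∀ u r → 2 ≤ length u → firstTwoDiffer _≟_ (u ++ r) ≡ firstTwoDiffer _≟_ u
  firstTwoDiffer-++ (a ∷ b ∷ u) r _ = refl
  firstTwoDiffer-++ (a ∷ []) r (s≤s ())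

  lastTwoDiffer-++ : ∀ q v → 2 ≤ length v →
                     firstTwoDiffer _≟_ (reverse (q ++ v)) ≡ firstTwoDiffer _≟_ (reverse v)
  lastTwoDiffer-++ q v 2≤|v| = trans (cong (firstTwoDiffer _≟_) (reverse-++ q v))
    (firstTwoDiffer-++ (reverse v) (reverse q) (subst (2 ≤_) (sym (length-reverse v)) 2≤|v|))

  lastTwoDiffer-shortenFirstRun : ∀ w → 2 ≤ runs w →
    firstTwoDiffer _≟_ (reverse (shortenFirstRun _≟_ w)) ≡ firstTwoDiffer _≟_ (reverse w)
  lastTwoDiffer-shortenFirstRun w 2≤runs =
    trans (sym (lastTwoDiffer-++ q (shortenFirstRun _≟_ w) 2≤length))
          (cong (firstTwoDiffer _≟_ ∘ reverse) (sym w≡q++))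
    where
      q : List (Char Σ)
      q = proj₁ (shortenFirstRun-suffix w)
      w≡q++ : w ≡ q ++ shortenFirstRun _≟_ w
      w≡q++ = proj₂ (shortenFirstRun-suffix w)
      2≤length : 2 ≤ length (shortenFirstRun _≟_ w)
      2≤length = ≤-trans (subst (2 ≤_) (sym (runs-shortenFirstRun w)) 2≤runs)
                         (length-derun _≟ᶜ_ (shortenFirstRun _≟_ w))

  dropEndRuns : List (Char Σ) → List (Char Σ)
  dropEndRuns w = reverse (dropFirstRun _≟_ (reverse (dropFirstRun _≟_ w)))

  shortenEndRuns : List (Char Σ) → List (Char Σ)
  shortenEndRuns w = reverse (shortenFirstRun _≟_ (reverse (shortenFirstRun _≟_ w)))

  runs-dropEndRuns : ∀ w → runs (dropEndRuns w) ≡ runs w ∸ 2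
  runs-dropEndRuns w = begin
    runs (reverse (dropFirstRun _≟_ (reverse d)))  ≡⟨ runs-reverse (dropFirstRun _≟_ (reverse d)) ⟩
    runs (dropFirstRun _≟_ (reverse d))            ≡⟨ runs-dropFirstRun (reverse d) ⟩
    runs (reverse d) ∸ 1                           ≡⟨ cong (_∸ 1) (runs-reverse d) ⟩
    runs d ∸ 1                                     ≡⟨ cong (_∸ 1) (runs-dropFirstRun w) ⟩
    runs w ∸ 1 ∸ 1                                 ≡⟨ ∸-+-assoc (runs w) 1 1 ⟩
    runs w ∸ 2                                     ∎
    where
      d : List (Char Σ)
      d = dropFirstRun _≟_ w

  runs-shortenEndRuns : ∀ w → runs (shortenEndRuns w) ≡ runs w
  runs-shortenEndRuns w = begin
    runs (reverse (shortenFirstRun _≟_ (reverse e)))  ≡⟨ runs-reverse (shortenFirstRun _≟_ (reverse e)) ⟩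
    runs (shortenFirstRun _≟_ (reverse e))            ≡⟨ runs-shortenFirstRun (reverse e) ⟩
    runs (reverse e)                                  ≡⟨ runs-reverse e ⟩
    runs e                                            ≡⟨ runs-shortenFirstRun w ⟩
    runs w                                            ∎
    where
      e : List (Char Σ)
      e = shortenFirstRun _≟_ w

  dropEndRuns-infix : ∀ w → Infix (dropEndRuns w) w
  dropEndRuns-infix w = infix-trans
    (infix-reverse-conj (dropFirstRun _≟_) dropFirstRun-infix (dropFirstRun _≟_ w))
    (dropFirstRun-infix w)

  shortenEndRuns-infix : ∀ w → Infix (shortenEndRuns w) w
  shortenEndRuns-infix w = infix-trans
    (infix-reverse-conj (shortenFirstRun _≟_) shortenFirstRun-infix (shortenFirstRun _≟_ w))
    (shortenFirstRun-infix w)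

  isBridge-shortenEndRuns : ∀ w → 2 ≤ runs w → isBridge _≟_ (shortenEndRuns w) ≡ true
  isBridge-shortenEndRuns w 2≤runs = cong₂ _∧_ firstTwo lastTwo
    where
      ftd : List (Char Σ) → Bool
      ftd = firstTwoDiffer _≟_
      e g : List (Char Σ)
      e = shortenFirstRun _≟_ w
      g = shortenFirstRun _≟_ (reverse e)
      2≤runs-rev-e : 2 ≤ runs (reverse e)
      2≤runs-rev-e = subst (2 ≤_) (sym (trans (runs-reverse e) (runs-shortenFirstRun w))) 2≤runs
      firstTwo : ftd (reverse g) ≡ true
      firstTwo = begin
        ftd (reverse g)                      ≡⟨ lastTwoDiffer-shortenFirstRun (reverse e) 2≤runs-rev-e ⟩
        ftd (reverse (reverse e))            ≡⟨ cong ftd (reverse-involutive e) ⟩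
        ftd e                                ≡⟨ firstTwoDiffer-shortenFirstRun w 2≤runs ⟩
        true                                 ∎
      lastTwo : ftd (reverse (reverse g)) ≡ true
      lastTwo = trans (cong ftd (reverse-involutive g))
                      (firstTwoDiffer-shortenFirstRun (reverse e) 2≤runs-rev-e)

  runs-step : ∀ w → runs (step _≟_ w) ≡ runs w ∸ 2
  runs-step w with runs w ≤ᵇ 2 | ≤ᵇ-reflects-≤ (runs w) 2
  ... | true | ofʸ runs≤2 = sym (m≤n⇒m∸n≡0 runs≤2)
  ... | false | ofⁿ _ = trans (runs-shortenEndRuns (dropEndRuns w)) (runs-dropEndRuns w)

  step-infix : ∀ w → Infix (step _≟_ w) w
  step-infix w with runs w ≤ᵇ 2
  ... | true = [] , w , refl
  ... | false = infix-trans (shortenEndRuns-infix (dropEndRuns w)) (dropEndRuns-infix w)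

  isBridge-step : ∀ w → 4 ≤ runs w → isBridge _≟_ (step _≟_ w) ≡ true
  isBridge-step w 4≤runs with runs w ≤ᵇ 2 | ≤ᵇ-reflects-≤ (runs w) 2
  ... | true | ofʸ runs≤2 = ⊥-elim (<⇒≱ (≤-trans (n≤1+n 3) 4≤runs) runs≤2)
  ... | false | ofⁿ _ = isBridge-shortenEndRuns (dropEndRuns w)
                          (subst (2 ≤_) (sym (runs-dropEndRuns w)) (∸-monoˡ-≤ 2 4≤runs))

  runs-iter : ∀ j w → runs (iter _≟_ j w) ≡ runs w ∸ 2 * j
  runs-iter zero w = refl
  runs-iter (suc j) w = begin
    runs (step _≟_ (iter _≟_ j w))  ≡⟨ runs-step (iter _≟_ j w) ⟩
    runs (iter _≟_ j w) ∸ 2         ≡⟨ cong (_∸ 2) (runs-iter j w) ⟩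
    runs w ∸ 2 * j ∸ 2              ≡⟨ ∸-+-assoc (runs w) (2 * j) 2 ⟩
    runs w ∸ (2 * j + 2)            ≡⟨ cong (runs w ∸_) (trans (+-comm (2 * j) 2) (sym (*-suc 2 j))) ⟩
    runs w ∸ 2 * suc j              ∎

  iter-infix : ∀ j w → Infix (iter _≟_ j w) w
  iter-infix zero w = infix-refl w
  iter-infix (suc j) w = infix-trans (step-infix (iter _≟_ j w)) (iter-infix j w)

  2≤runs-isBridge : ∀ w → T (isBridge _≟_ w) → 2 ≤ runs w
  2≤runs-isBridge (x ∷ y ∷ ys) isB with x ≟ᶜ y
  ... | no _ = s≤s (subst (1 ≤_) (sym (runs-∷≡suc-dropWhile y ys)) (s≤s z≤n))

-- Bridges of T

T-does⇒ : ∀ {P : Set} (P? : Dec P) → T (does P?) → P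
T-does⇒ (yes p) _ = p

module Bridges {Σ : Set} (_≟_ : DecidableEquality Σ) (s : List Σ) where

  open Runs (_≟c_ _≟_)
  open Steps _≟_

  ∈𝓑⁻ : ∀ {w} → w ∈ 𝓑 _≟_ s → T (isBridge _≟_ w) × Infix w (text _≟_ s)
  ∈𝓑⁻ w∈𝓑 =
    let w∈subs , isB = ∈-filter⁻ (T? ∘ isBridge _≟_) (∈-deduplicate⁻ (_≟w_ _≟_) _ w∈𝓑)
    in isB , ∈-substrings⁻ (text _≟_ s) w∈subs

  ∈𝓑⁺ : ∀ {w} → T (isBridge _≟_ w) → Infix w (text _≟_ s) → w ∈ 𝓑 _≟_ s
  ∈𝓑⁺ isB w-infix =
    ∈-deduplicate⁺ (_≟w_ _≟_) (∈-filter⁺ (T? ∘ isBridge _≟_) (∈-substrings⁺ w-infix) isB)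

  runs-text : runs (text _≟_ s) ≤ 2 + rleSize _≟_ s
  runs-text = ≤-trans (runs-++-≤ (nothing ∷ []) (map just s ++ nothing ∷ []))
    (s≤s (≤-trans (runs-++-≤ (map just s) (nothing ∷ [])) (≤-reflexive (+-comm (rleSize _≟_ s) 1))))

  runs-𝓑 : ∀ {w} → w ∈ 𝓑 _≟_ s → runs w ≤ 2 + rleSize _≟_ s
  runs-𝓑 w∈𝓑 = ≤-trans (runs-infix-≤ (proj₂ (∈𝓑⁻ w∈𝓑))) runs-text

  iter-∈𝓑 : ∀ {z} i → z ∈ 𝓑 _≟_ s → 2 ≤ runs (iter _≟_ i z) → iter _≟_ i z ∈ 𝓑 _≟_ s
  iter-∈𝓑 zero z∈𝓑 _ = z∈𝓑
  iter-∈𝓑 {z} (suc j) z∈𝓑 2≤runs = ∈𝓑⁺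
    (Equivalence.from T-≡ (isBridge-step (iter _≟_ j z)
      (2≤n∸2⇒4≤n (subst (2 ≤_) (runs-step (iter _≟_ j z)) 2≤runs))))
    (infix-trans (iter-infix (suc j) z) (proj₂ (∈𝓑⁻ z∈𝓑)))
    where
      2≤n∸2⇒4≤n : ∀ {n} → 2 ≤ n ∸ 2 → 4 ≤ n
      2≤n∸2⇒4≤n {suc (suc n)} 2≤n = s≤s (s≤s 2≤n)

  ∈K⇒runs≤rleSize : ∀ {z w′} → w′ ∈ K _≟_ s z → runs z ≤ rleSize _≟_ s
  ∈K⇒runs≤rleSize {z} {w′} w′∈K =
    let w′∈𝓑 , step-w′≡z = ∈-filter⁻ (T? ∘ λ w′ → does (_≟w_ _≟_ (iter _≟_ 1 w′) z)) w′∈K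
    in subst (λ u → runs u ≤ rleSize _≟_ s) (T-does⇒ (_≟w_ _≟_ (iter _≟_ 1 w′) z) step-w′≡z)
         (subst (_≤ rleSize _≟_ s) (sym (runs-step w′)) (∸-monoˡ-≤ 2 (runs-𝓑 w′∈𝓑)))

-- Counting

module Counting {Σ : Set} (_≟_ : DecidableEquality Σ) (s : List Σ) where

  open Runs (_≟c_ _≟_)
  open Steps _≟_
  open Bridges _≟_ s

  private
    𝓑ₛ : List (List (Char Σ))
    𝓑ₛ = 𝓑 _≟_ s

    N : ℕ
    N = ⌊ rleSize _≟_ s /2⌋ ∸ 1

    I : List ℕ
    I = map suc (upTo N)

    short : List (Char Σ) → Bool
    short w = isShort (runs w)

    |K| |K|₊ : List (Char Σ) → ℕ
    |K| z = length (K _≟_ s z)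
    |K|₊ z = when (2 ≤ᵇ |K| z) (|K| z)

    ∑B₂₃ : ℕ
    ∑B₂₃ = ∑[ w ∈ 𝓑ₛ ] when (short w) (|K| w)

  K-nonempty⇒runs≤rleSize : ∀ z → 1 ≤ |K| z → runs z ≤ rleSize _≟_ s
  K-nonempty⇒runs≤rleSize z with K _≟_ s z in K≡
  ... | [] = λ ()
  ... | w′ ∷ _ = λ _ → ∈K⇒runs≤rleSize (subst (w′ ∈_) (sym K≡) (here refl))

  short-iter-count : ∀ {z} → z ∈ 𝓑ₛ → 1 ≤ |K| z → ∀ c →
                     when (short z) c + ∑[ i ∈ I ] when (short (iter _≟_ i z)) c ≡ c
  short-iter-count {z} z∈𝓑 1≤|K| c = trans
    (cong (when (short z) c +_) (∑-cong I λ {i} _ → cong (λ n → when (isShort n) c) (runs-iter i z)))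
    (∑-isShort-∸ N c (2≤runs-isBridge z (proj₁ (∈𝓑⁻ z∈𝓑)))
      (≤-trans (K-nonempty⇒runs≤rleSize z 1≤|K|) (m≤3+2*[⌊m/2⌋∸1] (rleSize _≟_ s))))

  𝒲-term : ∀ {z} → z ∈ 𝓑ₛ →
           when ((2 ≤ᵇ |K| z) ∨ short z) (|K| z) ≡
           when (short z) (|K| z) + ∑[ i ∈ I ] when (short (iter _≟_ i z)) (|K|₊ z)
  𝒲-term {z} z∈𝓑 with 2 ≤ᵇ |K| z | ≤ᵇ-reflects-≤ 2 (|K| z)
  ... | true | ofʸ 2≤|K| = sym (short-iter-count z∈𝓑 (≤-trans (s≤s z≤n) 2≤|K|) (|K| z))
  ... | false | ofⁿ _ = sym (trans (cong (when (short z) (|K| z) +_)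
                                         (∑-zero I λ {i} _ → when-zero (short (iter _≟_ i z))))
                                  (+-identityʳ _))

  ∑-short-iter≡ : ∀ {z} → z ∈ 𝓑ₛ → ∀ i c →
    ∑[ w ∈ 𝓑ₛ ] when (short w) (when (does (_≟w_ _≟_ (iter _≟_ i z) w)) c) ≡
    when (short (iter _≟_ i z)) c
  ∑-short-iter≡ {z} z∈𝓑 i c = trans
    (∑-cong 𝓑ₛ λ {w} _ → when-comm (short w) _ c)
    (∑-select (_≟w_ _≟_) 𝓑ₛ (deduplicate-! (_≟w_ _≟_) _)
      λ iter∉𝓑 → when-false c λ short-iter → iter∉𝓑 (iter-∈𝓑 i z∈𝓑 (isShort⇒2≤ short-iter)))

  ∑-Kt₊ : ∀ i w → ∑[ z ∈ Kt₊ _≟_ s i w ] |K| z ≡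
                  ∑[ z ∈ 𝓑ₛ ] when (does (_≟w_ _≟_ (iter _≟_ i z) w)) (|K|₊ z)
  ∑-Kt₊ i w = trans (∑-filterᵇ (λ z → 2 ≤ᵇ |K| z) |K| (Kt _≟_ s i w))
                    (∑-filterᵇ (λ z → does (_≟w_ _≟_ (iter _≟_ i z) w)) |K|₊ 𝓑ₛ)

  split : ℕ
  split = ∑B₂₃ + ∑[ z ∈ 𝓑ₛ ] ∑[ i ∈ I ] when (short (iter _≟_ i z)) (|K|₊ z)

  𝒳≡split : 𝒳 _≟_ s ≡ split
  𝒳≡split = begin
    𝒳 _≟_ s
      ≡⟨ ∑-filterᵇ (λ z → (2 ≤ᵇ |K| z) ∨ short z) |K| 𝓑ₛ ⟩
    ∑[ z ∈ 𝓑ₛ ] when ((2 ≤ᵇ |K| z) ∨ short z) (|K| z)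
      ≡⟨ ∑-cong 𝓑ₛ 𝒲-term ⟩
    ∑[ z ∈ 𝓑ₛ ] (when (short z) (|K| z) + ∑[ i ∈ I ] when (short (iter _≟_ i z)) (|K|₊ z))
      ≡⟨ ∑-+ _ _ 𝓑ₛ ⟩
    split ∎

  rhs≡split : rhs _≟_ s ≡ split
  rhs≡split = begin
    rhs _≟_ s
      ≡⟨ ∑-filterᵇ short _ 𝓑ₛ ⟩
    ∑[ w ∈ 𝓑ₛ ] when (short w) (|K| w + ∑[ i ∈ I ] ∑[ z ∈ Kt₊ _≟_ s i w ] |K| z)
      ≡⟨ ∑-cong 𝓑ₛ (λ {w} _ → B₂₃-term w) ⟩
    ∑[ w ∈ 𝓑ₛ ] (when (short w) (|K| w) + ∑[ i ∈ I ] ∑[ z ∈ 𝓑ₛ ] h w i z)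
      ≡⟨ ∑-+ _ _ 𝓑ₛ ⟩
    ∑B₂₃ + ∑[ w ∈ 𝓑ₛ ] ∑[ i ∈ I ] ∑[ z ∈ 𝓑ₛ ] h w i z
      ≡⟨ cong (∑B₂₃ +_) (∑-swap₃ h 𝓑ₛ I 𝓑ₛ) ⟩
    ∑B₂₃ + ∑[ z ∈ 𝓑ₛ ] ∑[ i ∈ I ] ∑[ w ∈ 𝓑ₛ ] h w i z
      ≡⟨ cong (∑B₂₃ +_) (∑-cong 𝓑ₛ λ {z} z∈𝓑 → ∑-cong I λ {i} _ →
                           ∑-short-iter≡ z∈𝓑 i (|K|₊ z)) ⟩
    split ∎
    where
      h : List (Char Σ) → ℕ → List (Char Σ) → ℕ
      h w i z = when (short w) (when (does (_≟w_ _≟_ (iter _≟_ i z) w)) (|K|₊ z))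

      B₂₃-term : ∀ w → when (short w) (|K| w + ∑[ i ∈ I ] ∑[ z ∈ Kt₊ _≟_ s i w ] |K| z) ≡
                       when (short w) (|K| w) + ∑[ i ∈ I ] ∑[ z ∈ 𝓑ₛ ] h w i z
      B₂₃-term w = trans (when-+ (short w) _ _) (cong (when (short w) (|K| w) +_)
        (trans (when-∑ (short w) (λ i → ∑[ z ∈ Kt₊ _≟_ s i w ] |K| z) I) (∑-cong I λ {i} _ →
          trans (cong (when (short w)) (∑-Kt₊ i w)) (when-∑ (short w) _ 𝓑ₛ))))

lemma7 : {Σ : Set} (_≟_ : DecidableEquality Σ) (s : List Σ) → s ≢ [] →
    𝒳 _≟_ s ≡ rhs _≟_ s
lemma7 _≟_ s _ = trans 𝒳≡split (sym rhs≡split)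
  where open Counting _≟_ s
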